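{- Let $H$ be any graph and let $f$ be a function on the nonnegative integers such that $\chi(G') \leq f(\omega(G'))$ for every $(2K_2, H)$-free graph $G'$. Then every $(2K_2, K_1+H)$-free graph $G$ satisfies $\chi(G) \leq 2f(\omega(G)-1)+1$.
   Context: All graphs are finite, simple and undirected. $2K_2$ is the disjoint union of two edges. $K_1+H$ denotes the join of a single vertex with $H$, i.e. $H$ together with a new vertex adjacent to all vertices of $H$. A graph is $\mathcal{F}$-free if it has no induced subgraph isomorphic to a member of $\mathcal{F}$. $\chi$ is the chromatic number and $\omega$ the clique number. -}

module Defs where

open import Data.Nat using (ℕ; zero; suc; _≤_)
open import Data.Fin using (Fin; zero; suc)
open import Data.Bool using (Bool; true; false)
open import Data.Product using (Σ; _×_; _,_; ∃-syntax)
open import Relation.Binary.PropositionalEquality using (_≡_; _≢_)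
open import Relation.Nullary using (¬_)
open import Function.Definitions using (Injective)

record Graph : Set where
  field
    n      : ℕ
    adj    : Fin n → Fin n → Bool
    sym    : ∀ i j → adj i j ≡ adj j i
    irrefl : ∀ i → adj i i ≡ false
open Graph public

InducedSub : Graph → Graph → Set
InducedSub H G =
  Σ (Fin (n H) → Fin (n G)) λ φ →
    Injective _≡_ _≡_ φ × (∀ i j → adj H i j ≡ adj G (φ i) (φ j))

Free₂ : Graph → Graph → Graph → Set
Free₂ F₁ F₂ G = ¬ InducedSub F₁ G × ¬ InducedSub F₂ G

private
  a2K2 : Fin 4 → Fin 4 → Bool
  a2K2 zero (suc zero) = true
  a2K2 (suc zero) zero = true
  a2K2 (suc (suc zero)) (suc (suc (suc zero))) = true
  a2K2 (suc (suc (suc zero))) (suc (suc zero)) = true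
  a2K2 _ _ = false

  s2K2 : ∀ i j → a2K2 i j ≡ a2K2 j i
  s2K2 zero zero = _≡_.refl
  s2K2 zero (suc zero) = _≡_.refl
  s2K2 zero (suc (suc zero)) = _≡_.refl
  s2K2 zero (suc (suc (suc zero))) = _≡_.refl
  s2K2 (suc zero) zero = _≡_.refl
  s2K2 (suc zero) (suc zero) = _≡_.refl
  s2K2 (suc zero) (suc (suc zero)) = _≡_.refl
  s2K2 (suc zero) (suc (suc (suc zero))) = _≡_.refl
  s2K2 (suc (suc zero)) zero = _≡_.refl
  s2K2 (suc (suc zero)) (suc zero) = _≡_.refl
  s2K2 (suc (suc zero)) (suc (suc zero)) = _≡_.refl
  s2K2 (suc (suc zero)) (suc (suc (suc zero))) = _≡_.refl
  s2K2 (suc (suc (suc zero))) zero = _≡_.refl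
  s2K2 (suc (suc (suc zero))) (suc zero) = _≡_.refl
  s2K2 (suc (suc (suc zero))) (suc (suc zero)) = _≡_.refl
  s2K2 (suc (suc (suc zero))) (suc (suc (suc zero))) = _≡_.refl

  i2K2 : ∀ i → a2K2 i i ≡ false
  i2K2 zero = _≡_.refl
  i2K2 (suc zero) = _≡_.refl
  i2K2 (suc (suc zero)) = _≡_.refl
  i2K2 (suc (suc (suc zero))) = _≡_.refl

twoK₂ : Graph
twoK₂ = record { n = 4 ; adj = a2K2 ; sym = s2K2 ; irrefl = i2K2 }

private
  aJoin : (H : Graph) → Fin (suc (n H)) → Fin (suc (n H)) → Bool
  aJoin H zero zero = false
  aJoin H zero (suc j) = true
  aJoin H (suc i) zero = true
  aJoin H (suc i) (suc j) = adj H i j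

  sJoin : (H : Graph) → ∀ i j → aJoin H i j ≡ aJoin H j i
  sJoin H zero zero = _≡_.refl
  sJoin H zero (suc j) = _≡_.refl
  sJoin H (suc i) zero = _≡_.refl
  sJoin H (suc i) (suc j) = sym H i j

  iJoin : (H : Graph) → ∀ i → aJoin H i i ≡ false
  iJoin H zero = _≡_.refl
  iJoin H (suc i) = irrefl H i

K₁+ : Graph → Graph
K₁+ H = record { n = suc (n H) ; adj = aJoin H ; sym = sJoin H ; irrefl = iJoin H }

HasClique : Graph → ℕ → Set
HasClique G k =
  Σ (Fin k → Fin (n G)) λ φ →
    Injective _≡_ _≡_ φ × (∀ i j → i ≢ j → adj G (φ i) (φ j) ≡ true)

IsCliqueNumber : Graph → ℕ → Set
IsCliqueNumber G w = HasClique G w × (∀ k → HasClique G k → k ≤ w)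

Colourable : Graph → ℕ → Set
Colourable G c =
  Σ (Fin (n G) → Fin c) λ col →
    ∀ i j → adj G i j ≡ true → col i ≢ col j

χ≤ : Graph → ℕ → Set
χ≤ G c = Colourable G c

-- Let uv be an edge of a maximum clique of G. Every neighbourhood of G is (2K₂, H)-free
-- (a copy of H next to u would give K₁ + H) and, u lying in a maximum clique, has clique
-- number ω(G) − 1; so N(u) and N(v) are f(ω − 1)-colourable. The vertices adjacent to
-- neither u nor v form an independent set, since an edge among them would form a 2K₂ with
-- uv. Colouring N(u), N(v) ∖ N(u) and the rest with disjoint palettes uses 2f(ω − 1) + 1
-- colours.
module Submission where

open import Defs
open import Data.Nat using (ℕ; zero; suc; _+_; _*_; _∸_; _≤_; z≤n; s≤s)
open import Data.Nat.Properties using (m≤n+m; ≤-trans; ≤-pred; +-assoc; +-identityʳ)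
open import Data.Fin using (Fin; zero; suc; join; splitAt; punchIn; inject≤; _≟_)
open import Data.Fin.Properties using (all?; splitAt-join; inject≤-injective; punchIn-injective; punchInᵢ≢i)
open import Data.Bool using (true; false)
open import Data.Bool.Properties using (¬-not) renaming (_≟_ to _≟ᵇ_)
open import Data.Empty using (⊥-elim)
open import Data.Product using (_,_; proj₁; proj₂)
open import Data.Sum using (_⊎_; inj₁; inj₂)
open import Data.Sum.Properties using (inj₁-injective; inj₂-injective)
open import Data.List as List using (List; length; lookup; filter; allFin)
open import Data.List.Relation.Unary.All as All using ()
open import Data.List.Relation.Unary.Any as Any using ()
open import Data.List.Relation.Unary.Any.Properties using (lookup-index)
open import Data.List.Relation.Unary.Unique.Propositional using (Unique)
open import Data.List.Relation.Unary.Unique.Propositional.Properties using (filter⁺; allFin⁺)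
open import Data.List.Membership.Propositional.Properties using (∈-lookup; ∈-allFin; ∈-filter⁺; ∈-filter⁻)
open import Data.Vec.Functional using ([]; _∷_)
open import Function using (_∘_)
open import Level using (0ℓ)
open import Function.Definitions using (Injective)
open import Relation.Binary.PropositionalEquality using (_≡_; _≢_; refl; trans; cong; cong₂; subst; module ≡-Reasoning)
  renaming (sym to ≡-sym)
open import Relation.Nullary using (¬_; Dec; yes; no)
open import Relation.Nullary.Decidable using (from-yes; _→-dec_)
open import Relation.Unary using (Pred; Decidable)
open import Relation.Unary.Properties using (∁?)

Adjacent : (G : Graph) → Fin (n G) → Fin (n G) → Set
Adjacent G i j = adj G i j ≡ true

adjacent? : (G : Graph) (i : Fin (n G)) → Decidable (Adjacent G i)
adjacent? G i j = adj G i j ≟ᵇ true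

adjacent-sym : (G : Graph) {i j : Fin (n G)} → Adjacent G i j → Adjacent G j i
adjacent-sym G {i} {j} e = trans (Graph.sym G j i) e

adjacent⇒≢ : (G : Graph) {i j : Fin (n G)} → Adjacent G i j → i ≢ j
adjacent⇒≢ G {i} e refl with trans (≡-sym (irrefl G i)) e
... | ()

lookup-injective : {A : Set} {xs : List A} {i j : Fin (length xs)} →
                   Unique xs → lookup xs i ≡ lookup xs j → i ≡ j
lookup-injective {xs = _ List.∷ _} {zero}  {zero}  _                   _  = refl
lookup-injective {xs = _ List.∷ _} {zero}  {suc j} (x∉xs Unique.∷ _)   eq = ⊥-elim (All.lookup x∉xs (∈-lookup j) eq)
lookup-injective {xs = _ List.∷ _} {suc i} {zero}  (x∉xs Unique.∷ _)   eq = ⊥-elim (All.lookup x∉xs (∈-lookup i) (≡-sym eq))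
lookup-injective {xs = _ List.∷ _} {suc i} {suc j} (_ Unique.∷ unique) eq = cong suc (lookup-injective unique eq)

module _ (G : Graph) {P : Pred (Fin (n G)) 0ℓ} (P? : Decidable P) where
  private
    members : List (Fin (n G))
    members = filter P? (allFin (n G))

    member : ∀ {i} → P i → Any.Any (i ≡_) members
    member p = ∈-filter⁺ P? (∈-allFin _) p

  embed : Fin (length members) → Fin (n G)
  embed = lookup members

  _[_] : Graph
  _[_] = record
    { n      = length members
    ; adj    = λ a b → adj G (embed a) (embed b)
    ; sym    = λ a b → Graph.sym G (embed a) (embed b)
    ; irrefl = λ a → irrefl G (embed a)
    }

  embed-injective : Injective _≡_ _≡_ embed
  embed-injective = lookup-injective (filter⁺ P? (allFin⁺ (n G)))

  embed-satisfies : ∀ a → P (embed a)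
  embed-satisfies a = proj₂ (∈-filter⁻ P? {xs = allFin (n G)} (∈-lookup a))

  index : ∀ {i} → P i → Fin (n _[_])
  index p = Any.index (member p)

  embed-index : ∀ {i} (p : P i) → embed (index p) ≡ i
  embed-index p = ≡-sym (lookup-index (member p))

  index-injective : ∀ {i j} (p : P i) (q : P j) → index p ≡ index q → i ≡ j
  index-injective p q eq = trans (≡-sym (embed-index p)) (trans (cong embed eq) (embed-index q))

  adj-index : ∀ {i j} (p : P i) (q : P j) → adj _[_] (index p) (index q) ≡ adj G i j
  adj-index p q = cong₂ (adj G) (embed-index p) (embed-index q)

  restriction-InducedSub : InducedSub _[_] G
  restriction-InducedSub = embed , embed-injective , λ _ _ → refl

  InducedSub-restrict : ∀ {F} ((ι , ι-injective , ι-adj) : InducedSub F G) → (∀ a → P (ι a)) → InducedSub F _[_]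
  InducedSub-restrict (ι , ι-injective , ι-adj) p =
    (λ a → index (p a)) ,
    (λ eq → ι-injective (index-injective (p _) (p _) eq)) ,
    (λ a b → trans (ι-adj a b) (≡-sym (adj-index (p a) (p b))))

  HasClique-restrict : ∀ {k} ((φ , φ-injective , φ-clique) : HasClique G k) → (∀ a → P (φ a)) → HasClique _[_] k
  HasClique-restrict (φ , φ-injective , φ-clique) p =
    (λ a → index (p a)) ,
    (λ eq → φ-injective (index-injective (p _) (p _) eq)) ,
    (λ a b a≢b → trans (adj-index (p a) (p b)) (φ-clique a b a≢b))

InducedSub-trans : ∀ {F G K} → InducedSub F G → InducedSub G K → InducedSub F K
InducedSub-trans (ι , ι-injective , ι-adj) (κ , κ-injective , κ-adj) =
  κ ∘ ι , ι-injective ∘ κ-injective , λ a b → trans (ι-adj a b) (κ-adj (ι a) (ι b))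

join-injective : ∀ a b → Injective _≡_ _≡_ (join a b)
join-injective a b {x} {y} eq = trans (≡-sym (splitAt-join a b x)) (trans (cong (splitAt a) eq) (splitAt-join a b y))

colourable-mono : ∀ {G c d} → c ≤ d → Colourable G c → Colourable G d
colourable-mono c≤d (col , proper) =
  (λ i → inject≤ (col i) c≤d) , λ i j e eq → proper i j e (inject≤-injective c≤d c≤d _ _ eq)

colourable-InducedSub : ∀ {F G c} → InducedSub F G → Colourable G c → Colourable F c
colourable-InducedSub (ι , _ , ι-adj) (col , proper) =
  col ∘ ι , λ a b e → proper (ι a) (ι b) (trans (≡-sym (ι-adj a b)) e)

edgeless-colourable : (G : Graph) → (∀ i j → ¬ Adjacent G i j) → Colourable G 1
edgeless-colourable G no-edge = (λ _ → zero) , λ i j e _ → no-edge i j e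

colourable-split : ∀ (G : Graph) {P} (P? : Decidable P) {a b} →
                   Colourable (G [ P? ]) a → Colourable (G [ ∁? P? ]) b → Colourable G (a + b)
colourable-split G {P} P? {a} {b} (col₁ , proper₁) (col₂ , proper₂) =
  (λ i → join a b (side i (P? i))) ,
  (λ i j e eq → distinct e (P? i) (P? j) (join-injective a b eq))
  where
  side : ∀ i → Dec (P i) → Fin a ⊎ Fin b
  side i (yes p) = inj₁ (col₁ (index G P? p))
  side i (no ¬p) = inj₂ (col₂ (index G (∁? P?) ¬p))

  distinct : ∀ {i j} → Adjacent G i j → (dᵢ : Dec (P i)) (dⱼ : Dec (P j)) → side i dᵢ ≢ side j dⱼ
  distinct e (yes p) (yes q) eq = proper₁ _ _ (trans (adj-index G P? p q) e) (inj₁-injective eq)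
  distinct e (no ¬p) (no ¬q) eq = proper₂ _ _ (trans (adj-index G (∁? P?) ¬p ¬q) e) (inj₂-injective eq)
  distinct e (yes _) (no _) ()
  distinct e (no _) (yes _) ()

neighbourhood : (G : Graph) → Fin (n G) → Graph
neighbourhood G u = G [ adjacent? G u ]

module _ (G : Graph) (u : Fin (n G)) where
  private
    embedN = embed G (adjacent? G u)

  cone-injective : ∀ {m} {ψ : Fin m → Fin (n G)} → Injective _≡_ _≡_ ψ →
                   (∀ a → Adjacent G u (ψ a)) → Injective _≡_ _≡_ (u ∷ ψ)
  cone-injective ψ-injective u-ψ {zero}  {zero}  _  = refl
  cone-injective ψ-injective u-ψ {zero}  {suc b} eq = ⊥-elim (adjacent⇒≢ G (u-ψ b) eq)
  cone-injective ψ-injective u-ψ {suc a} {zero}  eq = ⊥-elim (adjacent⇒≢ G (u-ψ a) (≡-sym eq))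
  cone-injective ψ-injective u-ψ {suc a} {suc b} eq = cong suc (ψ-injective eq)

  neighbourhood-HasClique : ∀ {k} → HasClique (neighbourhood G u) k → HasClique G (suc k)
  neighbourhood-HasClique (φ , φ-injective , φ-clique) =
    u ∷ embedN ∘ φ , cone-injective (φ-injective ∘ embed-injective G _) u-φ , clique
    where
    u-φ = embed-satisfies G (adjacent? G u) ∘ φ
    clique : ∀ a b → a ≢ b → Adjacent G ((u ∷ embedN ∘ φ) a) ((u ∷ embedN ∘ φ) b)
    clique zero    zero    a≢b = ⊥-elim (a≢b refl)
    clique zero    (suc b) _   = u-φ b
    clique (suc a) zero    _   = adjacent-sym G (u-φ a)
    clique (suc a) (suc b) a≢b = φ-clique a b (a≢b ∘ cong suc)

  neighbourhood-K₁+ : ∀ {H} → InducedSub H (neighbourhood G u) → InducedSub (K₁+ H) G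
  neighbourhood-K₁+ {H} (ψ , ψ-injective , ψ-adj) =
    u ∷ embedN ∘ ψ , cone-injective (ψ-injective ∘ embed-injective G _) u-ψ , adj≡
    where
    u-ψ = embed-satisfies G (adjacent? G u) ∘ ψ
    adj≡ : ∀ a b → adj (K₁+ H) a b ≡ adj G ((u ∷ embedN ∘ ψ) a) ((u ∷ embedN ∘ ψ) b)
    adj≡ zero    zero    = ≡-sym (irrefl G u)
    adj≡ zero    (suc b) = ≡-sym (u-ψ b)
    adj≡ (suc a) zero    = ≡-sym (adjacent-sym G (u-ψ a))
    adj≡ (suc a) (suc b) = ψ-adj a b

  neighbourhood-Free₂ : ∀ {H} → Free₂ twoK₂ (K₁+ H) G → Free₂ twoK₂ H (neighbourhood G u)
  neighbourhood-Free₂ (no-2K₂ , no-K₁+H) =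
    (λ ι → no-2K₂ (InducedSub-trans {twoK₂} {neighbourhood G u} {G} ι (restriction-InducedSub G _))) ,
    no-K₁+H ∘ neighbourhood-K₁+

neighbourhood-cliqueNumber : ∀ (G : Graph) {k} ((φ , _) : HasClique G (suc k)) →
                             (∀ j → HasClique G j → j ≤ suc k) →
                             ∀ t → IsCliqueNumber (neighbourhood G (φ t)) k
neighbourhood-cliqueNumber G (φ , φ-injective , φ-clique) maximal t =
  HasClique-restrict G (adjacent? G (φ t)) others t-others ,
  λ j clique → ≤-pred (maximal (suc j) (neighbourhood-HasClique G (φ t) clique))
  where
  others : HasClique G _
  others = φ ∘ punchIn t ,
           punchIn-injective t _ _ ∘ φ-injective ,
           λ a b a≢b → φ-clique _ _ (a≢b ∘ punchIn-injective t a b)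
  t-others : ∀ a → Adjacent G (φ t) (φ (punchIn t a))
  t-others a = φ-clique t (punchIn t a) (punchInᵢ≢i t a ∘ ≡-sym)

twoK₂-partner : Fin 4 → Fin 4
twoK₂-partner zero                   = suc zero
twoK₂-partner (suc zero)             = zero
twoK₂-partner (suc (suc zero))       = suc (suc (suc zero))
twoK₂-partner (suc (suc (suc zero))) = suc (suc zero)

twoK₂-partner-adjacent : ∀ a → Adjacent twoK₂ a (twoK₂-partner a)
twoK₂-partner-adjacent = from-yes (all? λ a → adjacent? twoK₂ a (twoK₂-partner a))

twoK₂-partner-unique : ∀ a b → Adjacent twoK₂ b (twoK₂-partner a) → b ≡ a
twoK₂-partner-unique = from-yes (all? λ a → all? λ b → adjacent? twoK₂ b (twoK₂-partner a) →-dec b ≟ a)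

-- Each vertex of 2K₂ is the only neighbour of its partner, so adjacency-preserving maps
-- out of 2K₂ separate its vertices.
twoK₂-embedding-injective : ∀ G (ψ : Fin 4 → Fin (n G)) →
                            (∀ a b → adj twoK₂ a b ≡ adj G (ψ a) (ψ b)) → Injective _≡_ _≡_ ψ
twoK₂-embedding-injective G ψ ψ-adj {a} {b} eq =
  ≡-sym (twoK₂-partner-unique a b (begin
    adj twoK₂ b a′          ≡⟨ ψ-adj b a′ ⟩
    adj G (ψ b) (ψ a′)      ≡⟨ cong (λ x → adj G x (ψ a′)) (≡-sym eq) ⟩
    adj G (ψ a) (ψ a′)      ≡⟨ ≡-sym (ψ-adj a a′) ⟩
    adj twoK₂ a a′          ≡⟨ twoK₂-partner-adjacent a ⟩
    true                    ∎))
  where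
  open ≡-Reasoning
  a′ = twoK₂-partner a

module _ (G : Graph) {u v i j : Fin (n G)} (uv : Adjacent G u v) (ij : Adjacent G i j)
         (ui : adj G u i ≡ false) (uj : adj G u j ≡ false)
         (vi : adj G v i ≡ false) (vj : adj G v j ≡ false) where

  twoK₂-InducedSub : InducedSub twoK₂ G
  twoK₂-InducedSub = ψ , twoK₂-embedding-injective G ψ ψ-adj , ψ-adj
    where
    ψ : Fin 4 → Fin (n G)
    ψ = u ∷ v ∷ i ∷ j ∷ []

    reversed : ∀ {x y} → adj G x y ≡ false → false ≡ adj G y x
    reversed {x} {y} e = ≡-sym (trans (Graph.sym G y x) e)

    ψ-adj : ∀ a b → adj twoK₂ a b ≡ adj G (ψ a) (ψ b)
    ψ-adj zero                   zero                   = ≡-sym (irrefl G u)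
    ψ-adj zero                   (suc zero)             = ≡-sym uv
    ψ-adj zero                   (suc (suc zero))       = ≡-sym ui
    ψ-adj zero                   (suc (suc (suc zero))) = ≡-sym uj
    ψ-adj (suc zero)             zero                   = ≡-sym (adjacent-sym G uv)
    ψ-adj (suc zero)             (suc zero)             = ≡-sym (irrefl G v)
    ψ-adj (suc zero)             (suc (suc zero))       = ≡-sym vi
    ψ-adj (suc zero)             (suc (suc (suc zero))) = ≡-sym vj
    ψ-adj (suc (suc zero))       zero                   = reversed ui
    ψ-adj (suc (suc zero))       (suc zero)             = reversed vi
    ψ-adj (suc (suc zero))       (suc (suc zero))       = ≡-sym (irrefl G i)
    ψ-adj (suc (suc zero))       (suc (suc (suc zero))) = ≡-sym ij
    ψ-adj (suc (suc (suc zero))) zero                   = reversed uj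
    ψ-adj (suc (suc (suc zero))) (suc zero)             = reversed vj
    ψ-adj (suc (suc (suc zero))) (suc (suc zero))       = ≡-sym (adjacent-sym G ij)
    ψ-adj (suc (suc (suc zero))) (suc (suc (suc zero))) = ≡-sym (irrefl G j)

twoK₂-free-colourable : ∀ (G : Graph) {u v c} → ¬ InducedSub twoK₂ G → Adjacent G u v →
                        Colourable (neighbourhood G u) c → Colourable (neighbourhood G v) c →
                        Colourable G (2 * c + 1)
twoK₂-free-colourable G {u} {v} {c} no-2K₂ uv colour-u colour-v =
  subst (Colourable G) palettes
    (colourable-split G (adjacent? G u) colour-u
      (colourable-split R v? colour-v′ (edgeless-colourable (R [ ∁? v? ]) independent)))
  where
  palettes : c + (c + 1) ≡ 2 * c + 1
  palettes = trans (≡-sym (+-assoc c c 1)) (cong (λ x → c + x + 1) (≡-sym (+-identityʳ c)))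

  R : Graph
  R = G [ ∁? (adjacent? G u) ]

  v? : Decidable (λ a → Adjacent G v (embed G (∁? (adjacent? G u)) a))
  v? a = adjacent? G v (embed G (∁? (adjacent? G u)) a)

  R[v]↪G : InducedSub (R [ v? ]) G
  R[v]↪G = InducedSub-trans {R [ v? ]} {R} {G} (restriction-InducedSub R v?) (restriction-InducedSub G _)

  colour-v′ : Colourable (R [ v? ]) c
  colour-v′ = colourable-InducedSub {R [ v? ]} {neighbourhood G v}
                (InducedSub-restrict G (adjacent? G v) {R [ v? ]} R[v]↪G (embed-satisfies R v?))
                colour-v

  independent : ∀ a b → ¬ Adjacent (R [ ∁? v? ]) a b
  independent a b e = no-2K₂ (twoK₂-InducedSub G uv e (far-u a) (far-u b) (far-v a) (far-v b))
    where
    far-u : ∀ x → adj G u (embed G _ (embed R (∁? v?) x)) ≡ false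
    far-u x = ¬-not (embed-satisfies G (∁? (adjacent? G u)) (embed R (∁? v?) x))
    far-v : ∀ x → adj G v (embed G _ (embed R (∁? v?) x)) ≡ false
    far-v x = ¬-not (embed-satisfies R (∁? v?) x)

edge-HasClique : (G : Graph) {i j : Fin (n G)} → Adjacent G i j → HasClique G 2
edge-HasClique G {i} {j} e = i ∷ j ∷ [] , injective , clique
  where
  injective : Injective _≡_ _≡_ (i ∷ j ∷ [])
  injective = cone-injective G i (λ { {zero} {zero} _ → refl }) (λ { zero → e })

  clique : ∀ a b → a ≢ b → Adjacent G ((i ∷ j ∷ []) a) ((i ∷ j ∷ []) b)
  clique zero       zero       a≢b = ⊥-elim (a≢b refl)
  clique zero       (suc zero) _   = e
  clique (suc zero) zero       _   = adjacent-sym G e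
  clique (suc zero) (suc zero) a≢b = ⊥-elim (a≢b refl)

cliqueNumber≤1-colourable : ∀ (G : Graph) {w} → (∀ k → HasClique G k → k ≤ w) → w ≤ 1 → Colourable G 1
cliqueNumber≤1-colourable G maximal w≤1 =
  edgeless-colourable G (λ i j e → two≰one (≤-trans (maximal 2 (edge-HasClique G e)) w≤1))
  where
  two≰one : ¬ (2 ≤ 1)
  two≰one (s≤s ())

theorem3p12 : (H : Graph) (f : ℕ → ℕ)
    → (∀ (G' : Graph) (w : ℕ) → Free₂ twoK₂ H G' → IsCliqueNumber G' w → χ≤ G' (f w))
    → ∀ (G : Graph) (w : ℕ) → Free₂ twoK₂ (K₁+ H) G → IsCliqueNumber G w
    → χ≤ G (2 * f (w ∸ 1) + 1)
theorem3p12 H f χ-bound G (suc (suc k)) free (clique@(φ , _ , φ-clique) , maximal) =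
  twoK₂-free-colourable G (proj₁ free) (φ-clique zero (suc zero) (λ ())) (colour zero) (colour (suc zero))
  where
  colour : ∀ t → Colourable (neighbourhood G (φ t)) (f (suc k))
  colour t = χ-bound (neighbourhood G (φ t)) (suc k)
               (neighbourhood-Free₂ G (φ t) free)
               (neighbourhood-cliqueNumber G clique maximal t)
theorem3p12 H f χ-bound G zero _ (_ , maximal) =
  colourable-mono {G} (m≤n+m 1 _) (cliqueNumber≤1-colourable G maximal z≤n)
theorem3p12 H f χ-bound G (suc zero) _ (_ , maximal) =
  colourable-mono {G} (m≤n+m 1 _) (cliqueNumber≤1-colourable G maximal (s≤s z≤n))
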